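{- Let $a:\mathbb{N}\to\mathbb{C}$ be multiplicative, let $h,\lambda$ be coprime positive integers such that $a$ is $\lambda$-automatic, and let $\chi$ be a Dirichlet character of modulus $h\lambda$ with $a(n)=\chi(n)$ for all $n$ coprime to $h\lambda$. If $\lambda=p^\alpha$ is a power of a prime $p$ (with $\alpha\ge1$), then $a$ can be written in the form $a(n)=f_1(\nu_p(n))\cdot f_2(n/p^{\nu_p(n)})$ for all $n\in\mathbb{N}$, where $f_1:\mathbb{N}_0\to\mathbb{C}$ is eventually periodic with $f_1(0)=1$ and $f_2:\mathbb{N}\to\mathbb{C}$ is multiplicative and periodic.
   Context: A sequence is multiplicative if $u(mn)=u(m)u(n)$ for coprime $m,n$. For $\lambda\ge2$, $a$ is $\lambda$-automatic if its $\lambda$-kernel $\{(a(n\lambda^k+r))_{n\ge0}:k\ge0,0\le r<\lambda^k\}$ is finite. A Dirichlet character of modulus $k$ is a $k$-periodic completely multiplicative $\chi:\mathbb{Z}\to\mathbb{C}$ with $\chi(n)=0$ iff $\gcd(n,k)>1$. $\nu_p$ is the $p$-adic valuation. -}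

module Defs where

open import Level using (Level)
open import Data.Nat using (ℕ; zero; suc; _*_; _+_; _^_; _<_; _≤_; NonZero)
open import Data.Nat.DivMod using (_/_)
open import Data.Nat.Divisibility using (_∣_; _∣?_)
open import Data.Nat.GCD using (gcd)
open import Data.Nat.Coprimality using (Coprime)
open import Data.Integer as ℤ using (ℤ; +_; ∣_∣)
open import Data.Product using (Σ; ∃; _×_; _,_)
open import Data.List using (List)
open import Data.List.Relation.Unary.Any using (Any)
open import Relation.Nullary using (yes; no; ¬_)
open import Function.Bundles using (_⇔_)
open import Algebra.Bundles using (CommutativeRing)

module _ {c ℓ : Level} (R : CommutativeRing c ℓ) where
  open CommutativeRing R using (Carrier; _≈_; 0#; 1#) renaming (_*_ to _·_)

  Multiplicative : (ℕ → Carrier) → Set ℓ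
  Multiplicative u = ∀ m n → 1 ≤ m → 1 ≤ n → Coprime m n → u (m * n) ≈ u m · u n

  -- λ-kernel is finite: finitely many sequences s such that every kernel
  -- element (n ↦ a(n λ^k + r)) equals one of them (pointwise)
  Automatic : ℕ → (ℕ → Carrier) → Set (c Level.⊔ ℓ)
  Automatic lam a = Σ (List (ℕ → Carrier)) λ L →
    ∀ k r → r < lam ^ k →
      Any (λ s → ∀ n → s n ≈ a (n * lam ^ k + r)) L

  record DirichletCharacter (k : ℕ) (χ : ℤ → Carrier) : Set (c Level.⊔ ℓ) where
    field
      periodic : ∀ n → χ (n ℤ.+ + k) ≈ χ n
      completelyMultiplicative : ∀ m n → χ (m ℤ.* n) ≈ χ m · χ n
      zeroIff : ∀ n → (χ n ≈ 0#) ⇔ (1 < gcd ∣ n ∣ k)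

  Periodic : (ℕ → Carrier) → Set ℓ
  Periodic f = ∃ λ T → 1 ≤ T × (∀ n → 1 ≤ n → f (n + T) ≈ f n)

  EventuallyPeriodic : (ℕ → Carrier) → Set ℓ
  EventuallyPeriodic f = ∃ λ N → ∃ λ T → 1 ≤ T × (∀ k → N ≤ k → f (k + T) ≈ f k)

-- p-adic valuation (fuel-based; fuel n suffices for p ≥ 2, n ≥ 1); ν_p(0) := 0
private
  νgo : ℕ → (p : ℕ) → .{{NonZero p}} → ℕ → ℕ
  νgo zero p n = 0
  νgo (suc f) p zero = 0
  νgo (suc f) p (suc n) with p ∣? suc n
  ... | yes _ = suc (νgo f p (suc n / p))
  ... | no _ = 0

ν : (p : ℕ) → .{{NonZero p}} → ℕ → ℕ
ν p n = νgo n p n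

pFree : (p : ℕ) → .{{NonZero p}} → ℕ → ℕ
pFree p n = go n n
  where
  go : ℕ → ℕ → ℕ
  go zero m = m
  go (suc f) zero = zero
  go (suc f) (suc m) with p ∣? suc m
  ... | yes _ = go f (suc m / p)
  ... | no _ = suc m

-- Write q = p ^ α and M = h q. Splitting g into a divisor of a power of M times a unit shows
-- that a(g z) depends only on z mod M when z is a unit mod M. Pigeonhole on the finite q-kernel
-- gives a(n q^K + r) = a(n q^(K+D) + r) for all offsets r < q^k₀; with r = 0 this makes
-- k ↦ a(p^k) eventually periodic. For x prime to p, multiplying by a suitable u ≡ 1 (mod W h q),
-- where W = q^D − 1, brings x to X = n q^K + r without changing a, and the kernel identity then
-- replaces X by y = q^D X − r W. With G = gcd(x, W) and r chosen well, y = G Z for a unit Z mod M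
-- whose class mod M is the same for x and for x + T, T = W h q. Hence a(x + T) = a(x).
module Submission where

open import Defs
open import Level using (Level; 0ℓ)
open import Algebra.Bundles using (CommutativeRing)
open import Data.Nat
open import Data.Nat.Properties
open import Data.Nat.DivMod hiding (_mod_)
open import Data.Nat.Divisibility
open import Data.Nat.Coprimality as Coprimality using (Coprime; coprime?; coprime-divisor; coprime-Bézout)
open import Data.Nat.GCD
  using (gcd; gcd[m,n]∣m; gcd[m,n]∣n; gcd[m,n]≡0⇒m≡0; gcd[m,n]≡0⇒n≡0; gcd-greatest; module Bézout)
open import Data.Nat.Primality using (Prime; prime⇒irreducible; prime⇒nonTrivial; euclidsLemma)
open import Data.Nat.Induction using (<-rec)
open import Data.Integer as ℤ using (ℤ; +_)
open import Data.Fin using (Fin; toℕ)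
open import Data.Fin.Properties using (pigeonhole; toℕ≤pred[n])
open import Data.List using (length; lookup; _∷_; [])
open import Data.List.Relation.Unary.Any as Any using (Any)
open import Data.List.Relation.Unary.Any.Properties using (lookup-index)
open import Data.Product
open import Data.Sum using (_⊎_; inj₁; inj₂)
open import Data.Empty using (⊥-elim)
open import Function using (_∘_)
open import Relation.Nullary using (¬_; Dec; yes; no; contradiction)
open import Relation.Binary.Bundles using (Setoid)
open import Relation.Binary.PropositionalEquality as ≡ using (_≡_; refl; cong; cong₂; subst)
import Relation.Binary.Reasoning.Setoid as SetoidReasoning
open import Data.Nat.Tactic.RingSolver

∣m+n∣n⇒∣m : ∀ {d m n} → d ∣ m + n → d ∣ n → d ∣ m
∣m+n∣n⇒∣m {d} {m} {n} d∣m+n = ∣m+n∣m⇒∣n (subst (d ∣_) (+-comm m n) d∣m+n)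

m∣m^n : ∀ m {n} → 1 ≤ n → m ∣ m ^ n
m∣m^n m {suc n} _ = m∣m*n (m ^ n)

m≤n⇒m∣n! : ∀ {m n} → 1 ≤ m → m ≤ n → m ∣ n !
m≤n⇒m∣n! {suc m} _ m≤n = ∣-trans (m∣m*n (m !)) (m≤n⇒m!∣n! m≤n)

n<m^n : ∀ {m} → 1 < m → ∀ n → n < m ^ n
n<m^n m>1 zero = s≤s z≤n
n<m^n {m} m>1 (suc n) = begin-strict
  suc n       ≤⟨ n<m^n m>1 n ⟩
  m ^ n       <⟨ m<m*n (m ^ n) m m>1 ⟩
  m ^ n * m   ≡⟨ *-comm (m ^ n) m ⟩
  m * m ^ n   ∎
  where
  open ≤-Reasoning
  instance
    m^n≢0′ : NonZero (m ^ n)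
    m^n≢0′ = m^n≢0 m n {{>-nonZero (<-trans (s≤s z≤n) m>1)}}

-- Congruences

-- Stated with additions only, so that no truncated subtraction is involved.
infix 4 _≡_mod_

_≡_mod_ : ℕ → ℕ → ℕ → Set
x ≡ y mod m = ∃₂ λ i j → x + i * m ≡ y + j * m

module _ {m : ℕ} where

  ≡-mod-refl : ∀ {x} → x ≡ x mod m
  ≡-mod-refl = 0 , 0 , refl

  ≡-mod-reflexive : ∀ {x y} → x ≡ y → x ≡ y mod m
  ≡-mod-reflexive refl = ≡-mod-refl

  ≡-mod-sym : ∀ {x y} → x ≡ y mod m → y ≡ x mod m
  ≡-mod-sym (i , j , e) = j , i , ≡.sym e

  ≡-mod-trans : ∀ {x y z} → x ≡ y mod m → y ≡ z mod m → x ≡ z mod m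
  ≡-mod-trans {x} {y} {z} (i , j , e) (k , l , f) = i + k , j + l , (begin
    x + (i + k) * m       ≡⟨ solve (x ∷ i ∷ k ∷ m ∷ []) ⟩
    (x + i * m) + k * m   ≡⟨ cong (_+ k * m) e ⟩
    (y + j * m) + k * m   ≡⟨ solve (y ∷ j ∷ k ∷ m ∷ []) ⟩
    (y + k * m) + j * m   ≡⟨ cong (_+ j * m) f ⟩
    (z + l * m) + j * m   ≡⟨ solve (z ∷ j ∷ l ∷ m ∷ []) ⟩
    z + (j + l) * m       ∎)
    where open ≡.≡-Reasoning

  +-cong-mod : ∀ {x y u v} → x ≡ y mod m → u ≡ v mod m → x + u ≡ y + v mod m
  +-cong-mod {x} {y} {u} {v} (i , j , e) (k , l , f) = i + k , j + l , (begin
    x + u + (i + k) * m         ≡⟨ solve (x ∷ u ∷ i ∷ k ∷ m ∷ []) ⟩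
    (x + i * m) + (u + k * m)   ≡⟨ cong₂ _+_ e f ⟩
    (y + j * m) + (v + l * m)   ≡⟨ solve (y ∷ v ∷ j ∷ l ∷ m ∷ []) ⟩
    y + v + (j + l) * m         ∎)
    where open ≡.≡-Reasoning

  *-congˡ-mod : ∀ k {x y} → x ≡ y mod m → k * x ≡ k * y mod m
  *-congˡ-mod k {x} {y} (i , j , e) = k * i , k * j , (begin
    k * x + k * i * m   ≡⟨ solve (k ∷ x ∷ i ∷ m ∷ []) ⟩
    k * (x + i * m)     ≡⟨ cong (k *_) e ⟩
    k * (y + j * m)     ≡⟨ solve (k ∷ y ∷ j ∷ m ∷ []) ⟩
    k * y + k * j * m   ∎)
    where open ≡.≡-Reasoning

  *-congʳ-mod : ∀ k {x y} → x ≡ y mod m → x * k ≡ y * k mod m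
  *-congʳ-mod k {x} {y} x≡y rewrite *-comm x k | *-comm y k = *-congˡ-mod k x≡y

  +-cancelʳ-mod : ∀ {x y} k → x + k ≡ y + k mod m → x ≡ y mod m
  +-cancelʳ-mod {x} {y} k (i , j , e) = i , j , +-cancelʳ-≡ k _ _ (begin
    x + i * m + k   ≡⟨ solve (x ∷ i ∷ m ∷ k ∷ []) ⟩
    x + k + i * m   ≡⟨ e ⟩
    y + k + j * m   ≡⟨ solve (y ∷ j ∷ m ∷ k ∷ []) ⟩
    y + j * m + k   ∎)
    where open ≡.≡-Reasoning

  ∣⇒≡0-mod : ∀ {x} → m ∣ x → x ≡ 0 mod m
  ∣⇒≡0-mod {x} (divides q x≡qm) = 0 , q , ≡.trans (+-identityʳ x) x≡qm

  ≡0-mod⇒∣ : ∀ {x} → x ≡ 0 mod m → m ∣ x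
  ≡0-mod⇒∣ (i , j , e) = ∣m+n∣n⇒∣m (subst (m ∣_) (≡.sym e) (n∣m*n j)) (n∣m*n i)

  m∣k⇒x+k≡x : ∀ {k} → m ∣ k → ∀ x → x + k ≡ x mod m
  m∣k⇒x+k≡x m∣k x = ≡-mod-trans (+-cong-mod (≡-mod-refl {x}) (∣⇒≡0-mod m∣k)) (≡-mod-reflexive (+-identityʳ x))

  ∣-resp-≡-mod : ∀ {d x y} → d ∣ m → x ≡ y mod m → d ∣ x → d ∣ y
  ∣-resp-≡-mod {d} d∣m (i , j , e) d∣x =
    ∣m+n∣n⇒∣m (subst (d ∣_) e (∣m∣n⇒∣m+n d∣x (∣n⇒∣m*n i d∣m))) (∣n⇒∣m*n j d∣m)

  coprime-resp-≡-mod : ∀ {x y} → x ≡ y mod m → Coprime x m → Coprime y m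
  coprime-resp-≡-mod x≡y x⊥m (d∣y , d∣m) = x⊥m (∣-resp-≡-mod d∣m (≡-mod-sym x≡y) d∣y , d∣m)

  module _ .{{_ : NonZero m}} where

    %-≡-mod : ∀ x → x % m ≡ x mod m
    %-≡-mod x = x / m , 0 , ≡.trans (≡.sym (m≡m%n+[m/n]*n x m)) (≡.sym (+-identityʳ x))

    ≡-mod⇒x≡[x/m]*m+r : ∀ {x r} → x ≡ r mod m → r < m → x ≡ x / m * m + r
    ≡-mod⇒x≡[x/m]*m+r {x} {r} (i , j , e) r<m = begin
      x                   ≡⟨ m≡m%n+[m/n]*n x m ⟩
      x % m + x / m * m   ≡⟨ +-comm (x % m) _ ⟩
      x / m * m + x % m   ≡⟨ cong (_+_ (x / m * m)) x%m≡r ⟩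
      x / m * m + r       ∎
      where
      open ≡.≡-Reasoning
      x%m≡r : x % m ≡ r
      x%m≡r = begin
        x % m             ≡⟨ [m+kn]%n≡m%n x i m ⟨
        (x + i * m) % m   ≡⟨ cong (_% m) e ⟩
        (r + j * m) % m   ≡⟨ [m+kn]%n≡m%n r j m ⟩
        r % m             ≡⟨ m<n⇒m%n≡m r<m ⟩
        r                 ∎

+-inverse-mod : ∀ {m} → 1 ≤ m → ∀ x → x + (m ∸ 1) * x ≡ 0 mod m
+-inverse-mod {suc m} _ x = 0 , x , identity x m
  where
  identity : ∀ x m → x + m * x + 0 * suc m ≡ 0 + x * suc m
  identity = solve-∀

≡-mod-setoid : ℕ → Setoid 0ℓ 0ℓ
≡-mod-setoid m = record
  { Carrier = ℕ
  ; _≈_ = λ x y → x ≡ y mod m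
  ; isEquivalence = record { refl = ≡-mod-refl ; sym = ≡-mod-sym ; trans = ≡-mod-trans }
  }

module ≡-mod-Reasoning (m : ℕ) = SetoidReasoning (≡-mod-setoid m)

≡-mod-divisor : ∀ {d m x y} → d ∣ m → x ≡ y mod m → x ≡ y mod d
≡-mod-divisor {d} {m} {x} {y} (divides q m≡qd) (i , j , e) = i * q , j * q , (begin
  x + i * q * d   ≡⟨ cong (_+_ x) (≡.trans (*-assoc i q d) (cong (i *_) (≡.sym m≡qd))) ⟩
  x + i * m       ≡⟨ e ⟩
  y + j * m       ≡⟨ cong (_+_ y) (≡.trans (cong (j *_) m≡qd) (≡.sym (*-assoc j q d))) ⟩
  y + j * q * d   ∎)
  where open ≡.≡-Reasoning

*-cancelˡ-mod : ∀ k {m x y} .{{_ : NonZero k}} → k * x ≡ k * y mod k * m → x ≡ y mod m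
*-cancelˡ-mod k {m} {x} {y} (i , j , e) = i , j , *-cancelˡ-≡ _ _ k (begin
  k * (x + i * m)       ≡⟨ solve (k ∷ x ∷ i ∷ m ∷ []) ⟩
  k * x + i * (k * m)   ≡⟨ e ⟩
  k * y + j * (k * m)   ≡⟨ solve (k ∷ y ∷ j ∷ m ∷ []) ⟩
  k * (y + j * m)       ∎)
  where open ≡.≡-Reasoning

*-inverse-mod : ∀ {c m} → Coprime c m → ∃ λ i → i * c ≡ 1 mod m
*-inverse-mod {c} {zero} c⊥0 = 1 , ≡-mod-reflexive (≡.trans (*-identityˡ c) (c⊥0 (∣-refl , c ∣0)))
*-inverse-mod {c} {suc m} c⊥m with coprime-Bézout c⊥m
... | Bézout.+- x y 1+ym≡xc = x , 0 , y , ≡.trans (+-identityʳ (x * c)) (≡.sym 1+ym≡xc)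
-- Here x c ≡ −1, so x m c ≡ 1 modulo 1 + m.
... | Bézout.-+ x y 1+xc≡ym = x * m , y , x * c , (begin
  x * m * c + y * suc m     ≡⟨ cong (_+_ (x * m * c)) 1+xc≡ym ⟨
  x * m * c + (1 + x * c)   ≡⟨ solve (x ∷ m ∷ c ∷ []) ⟩
  1 + x * c * suc m         ∎)
  where open ≡.≡-Reasoning

chinese-remainder : ∀ {m n} .{{_ : NonZero m}} .{{_ : NonZero n}} → Coprime m n → ∀ a b →
  ∃ λ r → r < m * n × r ≡ a mod m × r ≡ b mod n
chinese-remainder {m} {n} m⊥n a b =
  r % (m * n) , m%n<n r (m * n) , reduce (m∣m*n n) r≡a , reduce (n∣m*n m) r≡b
  where
  instance
    mn≢0 : NonZero (m * n)
    mn≢0 = m*n≢0 m n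
  i = proj₁ (*-inverse-mod m⊥n)
  c = b + (n ∸ 1) * a
  r = a + i * m * c
  reduce : ∀ {d x} → d ∣ m * n → r ≡ x mod d → r % (m * n) ≡ x mod d
  reduce d∣mn = ≡-mod-trans (≡-mod-divisor d∣mn (%-≡-mod r))
  r≡a : r ≡ a mod m
  r≡a = m∣k⇒x+k≡x (∣m⇒∣m*n c (n∣m*n i)) a
  r≡b : r ≡ b mod n
  r≡b = begin
    a + i * m * c           ≈⟨ +-cong-mod (≡-mod-refl {x = a}) (*-congʳ-mod c (proj₂ (*-inverse-mod m⊥n))) ⟩
    a + 1 * c               ≡⟨ rearrange a b ((n ∸ 1) * a) ⟩
    b + (a + (n ∸ 1) * a)   ≈⟨ +-cong-mod (≡-mod-refl {x = b}) (+-inverse-mod (>-nonZero⁻¹ n) a) ⟩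
    b + 0                   ≡⟨ +-identityʳ b ⟩
    b                       ∎
    where
    open ≡-mod-Reasoning n
    rearrange : ∀ a b k → a + 1 * (b + k) ≡ b + (a + k)
    rearrange = solve-∀

residue-multiplier : ∀ {z Q P L r} → Coprime (z * Q) P → 1 ≤ P → L ∣ P → z ≡ r mod L →
  ∃ λ u → 1 ≤ u × u ≡ 1 mod Q * L × z * u ≡ r mod P
residue-multiplier {z} {Q} {P} {L} {r} zQ⊥P P≥1 L∣P z≡r =
  1 + Q * i * e , s≤s z≤n , u≡1 , zu≡r
  where
  i = proj₁ (*-inverse-mod zQ⊥P)
  e = r + (P ∸ 1) * z
  z+e≡r : z + e ≡ r mod P
  z+e≡r = begin
    z + (r + (P ∸ 1) * z)   ≡⟨ +-exchange z r ((P ∸ 1) * z) ⟩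
    r + (z + (P ∸ 1) * z)   ≈⟨ +-cong-mod (≡-mod-refl {x = r}) (+-inverse-mod P≥1 z) ⟩
    r + 0                   ≡⟨ +-identityʳ r ⟩
    r                       ∎
    where
    open ≡-mod-Reasoning P
    +-exchange : ∀ x y w → x + (y + w) ≡ y + (x + w)
    +-exchange = solve-∀
  L∣e : L ∣ e
  L∣e = ≡0-mod⇒∣ (+-cancelʳ-mod z (begin
    e + z   ≡⟨ +-comm e z ⟩
    z + e   ≈⟨ ≡-mod-divisor L∣P z+e≡r ⟩
    r       ≈⟨ ≡-mod-sym z≡r ⟩
    z       ∎))
    where open ≡-mod-Reasoning L
  u≡1 : 1 + Q * i * e ≡ 1 mod Q * L
  u≡1 = m∣k⇒x+k≡x (subst (Q * L ∣_) (≡.sym (*-assoc Q i e)) (*-monoʳ-∣ Q (∣n⇒∣m*n i L∣e))) 1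
  zu≡r : z * (1 + Q * i * e) ≡ r mod P
  zu≡r = begin
    z * (1 + Q * i * e)   ≡⟨ expand z Q i e ⟩
    z + i * (z * Q) * e   ≈⟨ +-cong-mod (≡-mod-refl {x = z}) (*-congʳ-mod e (proj₂ (*-inverse-mod zQ⊥P))) ⟩
    z + 1 * e             ≡⟨ cong (_+_ z) (*-identityˡ e) ⟩
    z + e                 ≈⟨ z+e≡r ⟩
    r                     ∎
    where
    open ≡-mod-Reasoning P
    expand : ∀ z Q i e → z * (1 + Q * i * e) ≡ z + i * (z * Q) * e
    expand = solve-∀

-- Coprimality

coprime-*ʳ : ∀ {a b c} → Coprime a b → Coprime a c → Coprime a (b * c)
coprime-*ʳ a⊥b a⊥c (d∣a , d∣bc) = a⊥c (d∣a , coprime-divisor d⊥b d∣bc)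
  where
  d⊥b : Coprime _ _
  d⊥b (e∣d , e∣b) = a⊥b (∣-trans e∣d d∣a , e∣b)

coprime-*ˡ : ∀ {a b c} → Coprime a c → Coprime b c → Coprime (a * b) c
coprime-*ˡ a⊥c b⊥c = Coprimality.sym (coprime-*ʳ (Coprimality.sym a⊥c) (Coprimality.sym b⊥c))

coprime-^ʳ : ∀ {a b} → Coprime a b → ∀ k → Coprime a (b ^ k)
coprime-^ʳ a⊥b zero    (_ , d∣1) = ∣1⇒≡1 d∣1
coprime-^ʳ a⊥b (suc k) = coprime-*ʳ a⊥b (coprime-^ʳ a⊥b k)

coprime-∣ˡ : ∀ {a b c} → Coprime a b → c ∣ a → Coprime c b
coprime-∣ˡ a⊥b c∣a (d∣c , d∣b) = a⊥b (∣-trans d∣c c∣a , d∣b)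

∤⇒coprime : ∀ {p n} → Prime p → ¬ p ∣ n → Coprime n p
∤⇒coprime p-prime p∤n (d∣n , d∣p) with prime⇒irreducible p-prime d∣p
... | inj₁ d≡1  = d≡1
... | inj₂ refl = ⊥-elim (p∤n d∣n)

coprime⇒≥1 : ∀ {z m} → 1 < m → Coprime z m → 1 ≤ z
coprime⇒≥1 {zero}  {m} 1<m 0⊥m = contradiction (0⊥m (m ∣0 , ∣-refl)) (>⇒≢ 1<m)
coprime⇒≥1 {suc z} _   _   = s≤s z≤n

record CoprimeFactorisation (A n : ℕ) : Set where
  constructor factorisation
  field
    smooth cofactor exponent : ℕ
    n≡smooth*cofactor : n ≡ smooth * cofactor
    smooth∣A^exponent : smooth ∣ A ^ exponent
    cofactor-coprime : Coprime cofactor A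

coprime-factorisation : ∀ A n → 1 ≤ n → CoprimeFactorisation A n
coprime-factorisation A = <-rec (λ n → 1 ≤ n → CoprimeFactorisation A n) step
  where
  step : ∀ n → (∀ {m} → m < n → 1 ≤ m → CoprimeFactorisation A m) → 1 ≤ n → CoprimeFactorisation A n
  step n rec n≥1 with coprime? n A
  ... | yes n⊥A = factorisation 1 n 0 (≡.sym (*-identityˡ n)) ∣-refl n⊥A
  ... | no ¬n⊥A = factorisation (g * smooth) cofactor (suc exponent) n≡g*s*t
                    (*-pres-∣ (gcd[m,n]∣n n A) smooth∣A^exponent) cofactor-coprime
    where
    g = gcd n A
    instance
      n≢0 : NonZero n
      n≢0 = >-nonZero n≥1
      g≢0 : NonZero g
      g≢0 = ≢-nonZero (λ g≡0 → ≢-nonZero⁻¹ n (gcd[m,n]≡0⇒m≡0 g≡0))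
    g≥2 : 2 ≤ g
    g≥2 = ≤∧≢⇒< (>-nonZero⁻¹ g) (¬n⊥A ∘ Coprimality.gcd≡1⇒coprime ∘ ≡.sym)
    open CoprimeFactorisation (rec (m/n<m n g g≥2) (m≥n⇒m/n>0 (∣⇒≤ (gcd[m,n]∣m n A))))
    n≡g*s*t : n ≡ g * smooth * cofactor
    n≡g*s*t = begin
      n                         ≡⟨ m/n*n≡m (gcd[m,n]∣m n A) ⟨
      n / g * g                 ≡⟨ *-comm (n / g) g ⟩
      g * (n / g)               ≡⟨ cong (g *_) n≡smooth*cofactor ⟩
      g * (smooth * cofactor)   ≡⟨ *-assoc g smooth cofactor ⟨
      g * smooth * cofactor     ∎
      where open ≡.≡-Reasoning

linear-form-coprime : ∀ {A B h} → 1 ≤ h → (∀ {d} → d ∣ A → d ∣ B → d ∣ h → d ≡ 1) →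
  ∃ λ ρ → Coprime (A + ρ * B) h
linear-form-coprime {A} {B} {h} h≥1 no-common-divisor =
  cofactor , subst (Coprime V) (≡.sym n≡smooth*cofactor) (coprime-*ʳ V⊥s V⊥t)
  where
  open CoprimeFactorisation (coprime-factorisation A h h≥1)
  V = A + cofactor * B
  s∣h : smooth ∣ h
  s∣h = divides cofactor (≡.trans n≡smooth*cofactor (*-comm smooth cofactor))
  V⊥t : Coprime V cofactor
  V⊥t (d∣V , d∣t) = cofactor-coprime (d∣t , ∣m+n∣n⇒∣m d∣V (∣m⇒∣m*n B d∣t))
  V⊥s : Coprime V smooth
  V⊥s {d} (d∣V , d∣s) = coprime-^ʳ d⊥A exponent (∣-refl , ∣-trans d∣s smooth∣A^exponent)
    where
    d⊥A : Coprime d A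
    d⊥A {e} (e∣d , e∣A) = no-common-divisor e∣A e∣B (∣-trans e∣d (∣-trans d∣s s∣h))
      where
      e⊥t : Coprime e cofactor
      e⊥t (f∣e , f∣t) = cofactor-coprime (f∣t , ∣-trans f∣e e∣A)
      e∣B : e ∣ B
      e∣B = coprime-divisor e⊥t (∣m+n∣m⇒∣n (∣-trans e∣d d∣V) e∣A)

-- Valuations

-- Defs keeps the fuelled recursions behind ν and pFree out of scope; each is recovered here
-- by unification, from its unfolding at a multiple of p.
mutual
  νFuel : ℕ → (p : ℕ) → .{{NonZero p}} → ℕ → ℕ
  νFuel = _

  pFreeFuel : (p : ℕ) → .{{NonZero p}} → ℕ → ℕ → ℕ
  pFreeFuel = _

  ν-unfold : ∀ p n .{{_ : NonZero p}} → p ∣ suc n → ν p (suc n) ≡ suc (νFuel n p (suc n / p))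
  ν-unfold p n p∣1+n with p ∣? suc n
  ... | no p∤1+n = ⊥-elim (p∤1+n p∣1+n)
  ... | yes _ with suc n / p
  ...   | _ = refl

  pFree-unfold : ∀ p n .{{_ : NonZero p}} → p ∣ suc n → pFree p (suc n) ≡ pFreeFuel p n (suc n / p)
  pFree-unfold p n p∣1+n with p ∣? suc n
  ... | no p∤1+n = ⊥-elim (p∤1+n p∣1+n)
  ... | yes _ with suc n / p
  ...   | _ = refl

module _ (p : ℕ) .{{_ : NonZero p}} (p>1 : 1 < p) where

  fuelled-factorisation : ∀ f m → 1 ≤ m → m ≤ f →
    m ≡ p ^ νFuel f p m * pFreeFuel p f m × ¬ p ∣ pFreeFuel p f m
  fuelled-factorisation (suc f) (suc m) _ (s≤s m≤f) with p ∣? suc m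
  ... | no p∤1+m = ≡.sym (*-identityˡ (suc m)) , p∤1+m
  ... | yes p∣1+m = 1+m≡p^ν*pFree , proj₂ rec
    where
    w = suc m / p
    p*w≡1+m : p * w ≡ suc m
    p*w≡1+m = m*[n/m]≡n p∣1+m
    w≥1 : 1 ≤ w
    w≥1 = m≥n⇒m/n>0 (∣⇒≤ p∣1+m)
    rec = fuelled-factorisation f w w≥1 (≤-trans (≤-pred (m/n<m (suc m) p p>1)) m≤f)
    1+m≡p^ν*pFree : suc m ≡ p ^ suc (νFuel f p w) * pFreeFuel p f w
    1+m≡p^ν*pFree = begin
      suc m                                   ≡⟨ p*w≡1+m ⟨
      p * w                                   ≡⟨ cong (p *_) (proj₁ rec) ⟩
      p * (p ^ νFuel f p w * pFreeFuel p f w) ≡⟨ *-assoc p _ _ ⟨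
      p ^ suc (νFuel f p w) * pFreeFuel p f w ∎
      where open ≡.≡-Reasoning

  valuation-factorisation : ∀ n → 1 ≤ n → n ≡ p ^ ν p n * pFree p n × ¬ p ∣ pFree p n
  valuation-factorisation n n≥1 = fuelled-factorisation n n n≥1 ≤-refl

-- Characters and automatic sequences

module _ {c ℓ : Level} (R : CommutativeRing c ℓ) where

  open CommutativeRing R using (Carrier; _≈_; setoid; reflexive)
  open import Relation.Binary.Reasoning.Setoid setoid

  module _ {k : ℕ} {χ : ℤ → Carrier} (χ-character : DirichletCharacter R k χ) where

    open DirichletCharacter χ-character using (periodic)

    χ-+-multiple : ∀ x i → χ (+ (x + i * k)) ≈ χ (+ x)
    χ-+-multiple x zero    = reflexive (cong (χ ∘ +_) (+-identityʳ x))
    χ-+-multiple x (suc i) = begin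
      χ (+ (x + (k + i * k)))   ≡⟨ cong (χ ∘ +_) (rearrange x k (i * k)) ⟩
      χ (+ (x + i * k + k))     ≈⟨ periodic (+ (x + i * k)) ⟩
      χ (+ (x + i * k))         ≈⟨ χ-+-multiple x i ⟩
      χ (+ x)                   ∎
      where
      rearrange : ∀ x k y → x + (k + y) ≡ x + y + k
      rearrange = solve-∀

    χ-resp-≡-mod : ∀ {x y} → x ≡ y mod k → χ (+ x) ≈ χ (+ y)
    χ-resp-≡-mod {x} {y} (i , j , x+ik≡y+jk) = begin
      χ (+ x)             ≈⟨ χ-+-multiple x i ⟨
      χ (+ (x + i * k))   ≡⟨ cong (χ ∘ +_) x+ik≡y+jk ⟩
      χ (+ (y + j * k))   ≈⟨ χ-+-multiple y j ⟩
      χ (+ y)             ∎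

  module _ {lam : ℕ} .{{_ : NonZero lam}} {a : ℕ → Carrier} (automatic : Automatic R lam a) where

    kernel-size : ℕ
    kernel-size = length (proj₁ automatic)

    module _ (r : ℕ) where

      private
        N = kernel-size

        kernel : ℕ → ℕ → Carrier
        kernel k n = a (n * lam ^ k + r)

        _≋_ : ℕ → ℕ → Set ℓ
        k ≋ k′ = ∀ n → kernel k n ≈ kernel k′ n

        kernel-shift : ∀ k k′ → k ≋ k′ → ∀ t → (k + t) ≋ (k′ + t)
        kernel-shift k k′ k≋k′ t n = begin
          a (n * lam ^ (k + t) + r)         ≡⟨ cong (λ m → a (m + r)) (split k) ⟩
          a (n * lam ^ t * lam ^ k + r)     ≈⟨ k≋k′ (n * lam ^ t) ⟩
          a (n * lam ^ t * lam ^ k′ + r)    ≡⟨ cong (λ m → a (m + r)) (split k′) ⟨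
          a (n * lam ^ (k′ + t) + r)        ∎
          where
          split : ∀ k → n * lam ^ (k + t) ≡ n * lam ^ t * lam ^ k
          split k = ≡.trans (cong (n *_) (^-distribˡ-+-* lam k t)) (reorder n (lam ^ k) (lam ^ t))
            where
            reorder : ∀ n x y → n * (x * y) ≡ n * y * x
            reorder = solve-∀

        kernel-iterate : ∀ k d → k ≋ (k + d) → ∀ q → k ≋ (k + q * d)
        kernel-iterate k d k≋k+d zero n = reflexive (cong (λ m → kernel m n) (≡.sym (+-identityʳ k)))
        kernel-iterate k d k≋k+d (suc q) n = begin
          kernel k n                  ≈⟨ kernel-iterate k d k≋k+d q n ⟩
          kernel (k + q * d) n        ≈⟨ kernel-shift k (k + d) k≋k+d (q * d) n ⟩
          kernel (k + d + q * d) n    ≡⟨ cong (λ m → kernel m n) (+-assoc k d (q * d)) ⟩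
          kernel (k + suc q * d) n    ∎

        kernel-repeat : ∀ {k} → r < lam ^ k → ∃₂ λ i j → i < j × j ≤ N × (k + i) ≋ (k + j)
        kernel-repeat {k} r<lam^k =
          let i , j , i<j , same-position = pigeonhole (n<1+n N) position
          in toℕ i , toℕ j , i<j , toℕ≤pred[n] j , λ n → begin
            kernel (k + toℕ i) n                    ≈⟨ lookup-index (member (toℕ i)) n ⟨
            lookup (proj₁ automatic) (position i) n ≡⟨ cong (λ s → lookup (proj₁ automatic) s n) same-position ⟩
            lookup (proj₁ automatic) (position j) n ≈⟨ lookup-index (member (toℕ j)) n ⟩
            kernel (k + toℕ j) n                    ∎
          where
          member : ∀ i → Any (λ s → ∀ n → s n ≈ kernel (k + i) n) (proj₁ automatic)
          member i = proj₂ automatic (k + i) r (≤-trans r<lam^k (^-monoʳ-≤ lam (m≤m+n k i)))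
          position : Fin (suc N) → Fin N
          position i = Any.index (member (toℕ i))

      kernel-eventually-periodic : ∀ {k} → r < lam ^ k → ∀ n →
        a (n * lam ^ (k + N) + r) ≈ a (n * lam ^ (k + N + N !) + r)
      kernel-eventually-periodic {k} r<lam^k n with kernel-repeat {k} r<lam^k
      ... | i , j , i<j , j≤N , k+i≋k+j = begin
        kernel (k + N) n                    ≡⟨ cong (λ m → kernel m n) k+N≡k+i+t ⟩
        kernel (k + i + t) n                ≈⟨ kernel-shift (k + i) (k + i + q * d) (kernel-iterate (k + i) d k+i≋k+i+d q) t n ⟩
        kernel (k + i + q * d + t) n        ≡⟨ cong (λ m → kernel m n) k+i+qd+t≡k+N+N! ⟩
        kernel (k + N + N !) n              ∎
        where
        d = j ∸ i
        t = N ∸ i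
        i+d≡j : i + d ≡ j
        i+d≡j = m+[n∸m]≡n (<⇒≤ i<j)
        i+t≡N : i + t ≡ N
        i+t≡N = m+[n∸m]≡n (≤-trans (<⇒≤ i<j) j≤N)
        k+i≋k+i+d : (k + i) ≋ (k + i + d)
        k+i≋k+i+d m = subst (λ x → kernel (k + i) m ≈ kernel x m)
          (≡.trans (cong (λ x → k + x) (≡.sym i+d≡j)) (≡.sym (+-assoc k i d))) (k+i≋k+j m)
        d∣N! : d ∣ N !
        d∣N! = m≤n⇒m∣n! (m<n⇒0<n∸m i<j) (≤-trans (m∸n≤m j i) j≤N)
        q = quotient d∣N!
        k+N≡k+i+t : k + N ≡ k + i + t
        k+N≡k+i+t = ≡.trans (cong (λ x → k + x) (≡.sym i+t≡N)) (≡.sym (+-assoc k i t))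
        k+i+qd+t≡k+N+N! : k + i + q * d + t ≡ k + N + N !
        k+i+qd+t≡k+N+N! = ≡.trans (reorder k i (q * d) t)
          (cong₂ (λ x y → k + x + y) i+t≡N (≡.sym (_∣_.equality d∣N!)))
          where
          reorder : ∀ k i x t → k + i + x + t ≡ k + (i + t) + x
          reorder = solve-∀

module AgreeingWithCharacter {c ℓ : Level} (R : CommutativeRing c ℓ)
  {a : ℕ → CommutativeRing.Carrier R} {M : ℕ} {χ : ℤ → CommutativeRing.Carrier R}
  (multiplicative : Multiplicative R a) (χ-character : DirichletCharacter R M χ)
  (a≈χ : ∀ n → 1 ≤ n → Coprime n M → CommutativeRing._≈_ R (a n) (χ (+ n))) (M>1 : 1 < M) where

  open CommutativeRing R using (_≈_; setoid; reflexive; trans; *-cong) renaming (_*_ to _·_; refl to ≈-refl)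
  module ≈-Reasoning = SetoidReasoning setoid

  a-*-resp-≡-mod : ∀ g {z z′} → 1 ≤ g → Coprime z M → z ≡ z′ mod M → a (g * z) ≈ a (g * z′)
  a-*-resp-≡-mod g {z} {z′} g≥1 z⊥M z≡z′ = begin
    a (g * z)                         ≈⟨ a-split z⊥M ⟩
    a smooth · χ (+ (cofactor * z))   ≈⟨ *-cong ≈-refl (χ-resp-≡-mod R χ-character (*-congˡ-mod cofactor z≡z′)) ⟩
    a smooth · χ (+ (cofactor * z′))  ≈⟨ a-split (coprime-resp-≡-mod z≡z′ z⊥M) ⟨
    a (g * z′)                        ∎
    where
    open ≈-Reasoning
    open CoprimeFactorisation (coprime-factorisation M g g≥1)
    s≥1 : 1 ≤ smooth
    s≥1 = >-nonZero⁻¹ smooth {{m*n≢0⇒m≢0 smooth {{s*t≢0}}}}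
      where
      s*t≢0 : NonZero (smooth * cofactor)
      s*t≢0 = subst NonZero n≡smooth*cofactor (>-nonZero g≥1)
    a-split : ∀ {z} → Coprime z M → a (g * z) ≈ a smooth · χ (+ (cofactor * z))
    a-split {z} z⊥M = begin
      a (g * z)                       ≡⟨ cong a (≡.trans (cong (_* z) n≡smooth*cofactor) (*-assoc smooth cofactor z)) ⟩
      a (smooth * (cofactor * z))     ≈⟨ multiplicative smooth (cofactor * z) s≥1 tz≥1 s⊥tz ⟩
      a smooth · a (cofactor * z)     ≈⟨ *-cong ≈-refl (a≈χ (cofactor * z) tz≥1 tz⊥M) ⟩
      a smooth · χ (+ (cofactor * z)) ∎
      where
      tz⊥M : Coprime (cofactor * z) M
      tz⊥M = coprime-*ˡ cofactor-coprime z⊥M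
      tz≥1 : 1 ≤ cofactor * z
      tz≥1 = coprime⇒≥1 M>1 tz⊥M
      s⊥tz : Coprime smooth (cofactor * z)
      s⊥tz (d∣s , d∣tz) = coprime-^ʳ tz⊥M exponent (d∣tz , ∣-trans d∣s smooth∣A^exponent)

  a-*-unit : ∀ {z u} → 1 ≤ z → u ≡ 1 mod M → a (z * u) ≈ a z
  a-*-unit {z} {u} z≥1 u≡1 =
    trans (a-*-resp-≡-mod z z≥1 u⊥M u≡1) (reflexive (cong a (*-identityʳ z)))
    where
    u⊥M : Coprime u M
    u⊥M = coprime-resp-≡-mod (≡-mod-sym u≡1) (Coprimality.1-coprimeTo M)

module Proposition5p4 {c ℓ : Level} (R : CommutativeRing c ℓ) (a : ℕ → CommutativeRing.Carrier R)
  (h p α : ℕ) (χ : ℤ → CommutativeRing.Carrier R) .{{_ : NonZero p}}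
  (multiplicative : Multiplicative R a) (h≥1 : 1 ≤ h) (h⊥q : Coprime h (p ^ α))
  (automatic : Automatic R (p ^ α) a) (χ-character : DirichletCharacter R (h * p ^ α) χ)
  (a≈χ : ∀ n → 1 ≤ n → Coprime n (h * p ^ α) → CommutativeRing._≈_ R (a n) (χ (+ n)))
  (p-prime : Prime p) (α≥1 : 1 ≤ α) where

  open CommutativeRing R using (Carrier; _≈_; 0#; 1#; setoid; reflexive; sym; trans; *-cong; zeroˡ; zeroʳ)
    renaming (_*_ to _·_; refl to ≈-refl; *-identityˡ to ·-identityˡ)
  module ≈-Reasoning = SetoidReasoning setoid

  q : ℕ
  q = p ^ α

  M : ℕ
  M = h * q

  instance
    q≢0 : NonZero q
    q≢0 = m^n≢0 p α
    h≢0 : NonZero h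
    h≢0 = >-nonZero h≥1

  -- Every residue mod q h is below q ^ k₀, hence a usable kernel offset.
  N D k₀ K W T : ℕ
  N = kernel-size R {lam = q} {a = a} automatic
  D = N !
  k₀ = suc h
  K = k₀ + N
  W = q ^ D ∸ 1
  T = W * h * q

  p>1 : 1 < p
  p>1 = nonTrivial⇒n>1 p {{prime⇒nonTrivial p-prime}}

  q>1 : 1 < q
  q>1 = <-≤-trans p>1 (∣⇒≤ (m∣m^n p α≥1))

  M>1 : 1 < M
  M>1 = <-≤-trans q>1 (m≤n*m q h)

  D≥1 : 1 ≤ D
  D≥1 = >-nonZero⁻¹ D {{N !≢0}}

  W+1≡q^D : W + 1 ≡ q ^ D
  W+1≡q^D = m∸n+n≡m (m^n>0 q D)

  W≥1 : 1 ≤ W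
  W≥1 = m<n⇒0<n∸m (<-≤-trans q>1 (∣⇒≤ {{m^n≢0 q D}} (m∣m^n q D≥1)))

  W⊥q : Coprime W q
  W⊥q {d} (d∣W , d∣q) = ∣1⇒≡1 (∣m+n∣m⇒∣n (subst (d ∣_) (≡.sym W+1≡q^D) (∣-trans d∣q (m∣m^n q D≥1))) d∣W)

  M∣T : M ∣ T
  M∣T = divides W (*-assoc W h q)

  q∣T : q ∣ T
  q∣T = n∣m*n (W * h)

  T≥1 : 1 ≤ T
  T≥1 = *-mono-≤ (*-mono-≤ W≥1 h≥1) (<⇒≤ q>1)

  p∤⇒⊥q : ∀ {z} → ¬ p ∣ z → Coprime z q
  p∤⇒⊥q p∤z = coprime-^ʳ (∤⇒coprime p-prime p∤z) α

  p∣T : p ∣ T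
  p∣T = ∣-trans (m∣m^n p α≥1) q∣T

  open AgreeingWithCharacter R multiplicative χ-character a≈χ M>1 using (a-*-resp-≡-mod; a-*-unit)

  lift-by-unit : ∀ {z r u} → ¬ p ∣ z → r < q ^ k₀ → z ≡ r mod q → u ≡ 1 mod T → z * u ≡ r mod q ^ K →
    ∃₂ λ X y → X ≡ z mod T × y ≡ z mod q × (y + r * W ≡ q ^ D * X) × a z ≈ a y
  lift-by-unit {z} {r} {u} p∤z r<q^k₀ z≡r u≡1 zu≡r = z * u , y , zu≡z , y≡z , y+rW≡q^D*zu , a-chain
    where
    instance
      q^K≢0 : NonZero (q ^ K)
      q^K≢0 = m^n≢0 q K
    n = z * u / q ^ K
    y = n * q ^ (K + D) + r
    zu≡nq^K+r : z * u ≡ n * q ^ K + r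
    zu≡nq^K+r = ≡-mod⇒x≡[x/m]*m+r zu≡r (<-≤-trans r<q^k₀ (^-monoʳ-≤ q (m≤m+n k₀ N)))
    zu≡z : z * u ≡ z mod T
    zu≡z = ≡-mod-trans (*-congˡ-mod z u≡1) (≡-mod-reflexive (*-identityʳ z))
    y≡z : y ≡ z mod q
    y≡z = begin
      n * q ^ (K + D) + r   ≡⟨ +-comm (n * q ^ (K + D)) r ⟩
      r + n * q ^ (K + D)   ≈⟨ m∣k⇒x+k≡x (∣n⇒∣m*n n (m∣m^n q {K + D} (s≤s z≤n))) r ⟩
      r                     ≈⟨ ≡-mod-sym z≡r ⟩
      z                     ∎
      where open ≡-mod-Reasoning q
    y+rW≡q^D*zu : y + r * W ≡ q ^ D * (z * u)
    y+rW≡q^D*zu = begin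
      n * q ^ (K + D) + r + r * W           ≡⟨ cong (λ s → n * s + r + r * W) (^-distribˡ-+-* q K D) ⟩
      n * (q ^ K * q ^ D) + r + r * W       ≡⟨ regroup n (q ^ K) (q ^ D) r W ⟩
      q ^ D * (n * q ^ K) + (W + 1) * r     ≡⟨ cong (λ s → q ^ D * (n * q ^ K) + s * r) W+1≡q^D ⟩
      q ^ D * (n * q ^ K) + q ^ D * r       ≡⟨ *-distribˡ-+ (q ^ D) _ r ⟨
      q ^ D * (n * q ^ K + r)               ≡⟨ cong (q ^ D *_) zu≡nq^K+r ⟨
      q ^ D * (z * u)                       ∎
      where
      open ≡.≡-Reasoning
      regroup : ∀ n a b r w → n * (a * b) + r + r * w ≡ b * (n * a) + (w + 1) * r
      regroup = solve-∀
    a-chain : a z ≈ a y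
    a-chain = begin
      a z                  ≈⟨ a-*-unit (coprime⇒≥1 q>1 (p∤⇒⊥q p∤z)) (≡-mod-divisor M∣T u≡1) ⟨
      a (z * u)            ≡⟨ cong a zu≡nq^K+r ⟩
      a (n * q ^ K + r)    ≈⟨ kernel-eventually-periodic R {lam = q} {a = a} automatic r {k = k₀} r<q^k₀ n ⟩
      a y                  ∎
      where open ≈-Reasoning

  lift-to-kernel : ∀ {z r} → ¬ p ∣ z → r < q ^ k₀ → z ≡ r mod q →
    ∃₂ λ X y → X ≡ z mod T × y ≡ z mod q × (y + r * W ≡ q ^ D * X) × a z ≈ a y
  lift-to-kernel {z} p∤z r<q^k₀ z≡r =
    let u , _ , u≡1 , zu≡r = residue-multiplier zWh⊥q^K (m^n>0 q K) (m∣m^n q {K} (s≤s z≤n)) z≡r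
    in lift-by-unit p∤z r<q^k₀ z≡r u≡1 zu≡r
    where
    zWh⊥q^K : Coprime (z * (W * h)) (q ^ K)
    zWh⊥q^K = coprime-^ʳ (coprime-*ˡ (p∤⇒⊥q p∤z) (coprime-*ˡ W⊥q h⊥q)) K

  -- r₀ ≡ x (mod q) serves as a kernel offset for both x and x + T, and r₀ ≡ −ρ (mod h) makes
  -- the quotient of each lift by G congruent mod h to V, which ρ makes a unit.
  module _ {x : ℕ} (p∤x : ¬ p ∣ x) where

    private
      G = gcd x W
      G∣x = gcd[m,n]∣m x W
      G∣W = gcd[m,n]∣n x W
      x₁ = quotient G∣x
      w₁ = quotient G∣W
      x≡x₁G : x ≡ x₁ * G
      x≡x₁G = _∣_.equality G∣x
      W≡w₁G : W ≡ w₁ * G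
      W≡w₁G = _∣_.equality G∣W

      instance
        G≢0 : NonZero G
        G≢0 = ≢-nonZero (λ G≡0 → ≢-nonZero⁻¹ W {{>-nonZero W≥1}} (gcd[m,n]≡0⇒n≡0 x G≡0))

      no-common-divisor : ∀ {d} → d ∣ q ^ D * x₁ → d ∣ w₁ → d ∣ h → d ≡ 1
      no-common-divisor {d} d∣q^Dx₁ d∣w₁ d∣h = ∣1⇒≡1 (*-cancelʳ-∣ G dG∣1G)
        where
        d∣x₁ : d ∣ x₁
        d∣x₁ = coprime-divisor (coprime-^ʳ (coprime-∣ˡ h⊥q d∣h) D) d∣q^Dx₁
        dG∣x : d * G ∣ x
        dG∣x = subst (d * G ∣_) (≡.sym x≡x₁G) (*-monoˡ-∣ G d∣x₁)
        dG∣W : d * G ∣ W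
        dG∣W = subst (d * G ∣_) (≡.sym W≡w₁G) (*-monoˡ-∣ G d∣w₁)
        dG∣1G : d * G ∣ 1 * G
        dG∣1G = subst (d * G ∣_) (≡.sym (*-identityˡ G)) (gcd-greatest dG∣x dG∣W)

      ρ = proj₁ (linear-form-coprime h≥1 no-common-divisor)
      V = q ^ D * x₁ + ρ * w₁
      V⊥h : Coprime V h
      V⊥h = proj₂ (linear-form-coprime h≥1 no-common-divisor)

      residue = chinese-remainder (Coprimality.sym h⊥q) x ((h ∸ 1) * ρ)
      r₀ = proj₁ residue
      r₀≡x : r₀ ≡ x mod q
      r₀≡x = proj₁ (proj₂ (proj₂ residue))

      r₀<q^k₀ : r₀ < q ^ k₀
      r₀<q^k₀ = <-≤-trans (proj₁ (proj₂ residue)) (*-monoʳ-≤ q (<⇒≤ (n<m^n q>1 h)))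

      r₀+ρ≡0 : r₀ + ρ ≡ 0 mod h
      r₀+ρ≡0 = begin
        r₀ + ρ              ≈⟨ +-cong-mod (proj₂ (proj₂ (proj₂ residue))) (≡-mod-refl {x = ρ}) ⟩
        (h ∸ 1) * ρ + ρ     ≡⟨ +-comm _ ρ ⟩
        ρ + (h ∸ 1) * ρ     ≈⟨ +-inverse-mod h≥1 ρ ⟩
        0                   ∎
        where open ≡-mod-Reasoning h

      Z+r₀w₁≡q^Dx₁ : ∀ {Z} → G * Z + r₀ * W ≡ q ^ D * x mod T → Z + r₀ * w₁ ≡ q ^ D * x₁ mod h
      Z+r₀w₁≡q^Dx₁ {Z} GZ+r₀W≡q^Dx = *-cancelˡ-mod G (≡-mod-divisor Gh∣T (begin
        G * (Z + r₀ * w₁)       ≡⟨ expand G Z r₀ w₁ ⟩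
        G * Z + r₀ * (w₁ * G)   ≡⟨ cong (λ w → G * Z + r₀ * w) W≡w₁G ⟨
        G * Z + r₀ * W          ≈⟨ GZ+r₀W≡q^Dx ⟩
        q ^ D * x               ≡⟨ cong (q ^ D *_) x≡x₁G ⟩
        q ^ D * (x₁ * G)        ≡⟨ reorder (q ^ D) x₁ G ⟩
        G * (q ^ D * x₁)        ∎))
        where
        open ≡-mod-Reasoning T
        Gh∣T : G * h ∣ T
        Gh∣T = ∣-trans (*-monoˡ-∣ h G∣W) (m∣m*n q)
        expand : ∀ g z r w → g * (z + r * w) ≡ g * z + r * (w * g)
        expand = solve-∀
        reorder : ∀ a x g → a * (x * g) ≡ g * (a * x)
        reorder = solve-∀

      quotient≡V : ∀ {Z} → G * Z + r₀ * W ≡ q ^ D * x mod T → Z ≡ V mod h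
      quotient≡V {Z} GZ+r₀W≡q^Dx = begin
        Z                           ≈⟨ m∣k⇒x+k≡x (≡0-mod⇒∣ (*-congʳ-mod w₁ r₀+ρ≡0)) Z ⟨
        Z + (r₀ + ρ) * w₁           ≡⟨ regroup Z r₀ ρ w₁ ⟩
        (Z + r₀ * w₁) + ρ * w₁      ≈⟨ +-cong-mod (Z+r₀w₁≡q^Dx₁ GZ+r₀W≡q^Dx) (≡-mod-refl {x = ρ * w₁}) ⟩
        q ^ D * x₁ + ρ * w₁         ∎
        where
        open ≡-mod-Reasoning h
        regroup : ∀ z r s w → z + (r + s) * w ≡ (z + r * w) + s * w
        regroup = solve-∀

      G∣T : G ∣ T
      G∣T = ∣-trans (∣-trans G∣W (m∣m*n h)) (m∣m*n q)

      divide-lift : ∀ {z X y} → ¬ p ∣ z → X ≡ x mod T → y ≡ z mod q → y + r₀ * W ≡ q ^ D * X →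
        ∃ λ Z → (y ≡ G * Z) × Coprime Z q × G * Z + r₀ * W ≡ q ^ D * x mod T
      divide-lift {z} {X} {y} p∤z X≡x y≡z y+r₀W≡q^DX = Z , y≡GZ , Z⊥q , GZ+r₀W≡q^Dx
        where
        G∣y : G ∣ y
        G∣y = ∣m+n∣n⇒∣m (subst (G ∣_) (≡.sym y+r₀W≡q^DX)
                (∣n⇒∣m*n (q ^ D) (∣-resp-≡-mod G∣T (≡-mod-sym X≡x) G∣x)))
                (∣n⇒∣m*n r₀ G∣W)
        Z = quotient G∣y
        y≡GZ : y ≡ G * Z
        y≡GZ = ≡.trans (_∣_.equality G∣y) (*-comm Z G)
        Z⊥q : Coprime Z q
        Z⊥q = coprime-∣ˡ (coprime-resp-≡-mod (≡-mod-sym y≡z) (p∤⇒⊥q p∤z)) (divides G y≡GZ)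
        GZ+r₀W≡q^Dx : G * Z + r₀ * W ≡ q ^ D * x mod T
        GZ+r₀W≡q^Dx = ≡-mod-trans (≡-mod-reflexive (≡.trans (cong (_+ r₀ * W) (≡.sym y≡GZ)) y+r₀W≡q^DX))
                                  (*-congˡ-mod (q ^ D) X≡x)

      lift-and-divide : ∀ {z} → ¬ p ∣ z → z ≡ x mod T →
        ∃ λ Z → a z ≈ a (G * Z) × Coprime Z q × G * Z + r₀ * W ≡ q ^ D * x mod T
      lift-and-divide {z} p∤z z≡x =
        let X , y , X≡z , y≡z , y+r₀W≡q^DX , az≈ay = lift-to-kernel p∤z r₀<q^k₀ z≡r₀
            Z , y≡GZ , Z⊥q , GZ+r₀W≡q^Dx = divide-lift p∤z (≡-mod-trans X≡z z≡x) y≡z y+r₀W≡q^DX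
        in Z , trans az≈ay (reflexive (cong a y≡GZ)) , Z⊥q , GZ+r₀W≡q^Dx
        where
        z≡r₀ : z ≡ r₀ mod q
        z≡r₀ = ≡-mod-trans (≡-mod-divisor q∣T z≡x) (≡-mod-sym r₀≡x)

      a-G*-resp-invariant : ∀ {Z Z′} → Coprime Z′ q →
        G * Z + r₀ * W ≡ q ^ D * x mod T → G * Z′ + r₀ * W ≡ q ^ D * x mod T → a (G * Z′) ≈ a (G * Z)
      a-G*-resp-invariant {Z} {Z′} Z′⊥q inv inv′ = a-*-resp-≡-mod G (>-nonZero⁻¹ G) Z′⊥M Z′≡Z
        where
        Z′⊥M : Coprime Z′ M
        Z′⊥M = coprime-*ʳ (coprime-resp-≡-mod (≡-mod-sym (quotient≡V inv′)) V⊥h) Z′⊥q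
        T≡G*w₁hq : T ≡ G * (w₁ * h * q)
        T≡G*w₁hq = ≡.trans (cong (λ w → w * h * q) W≡w₁G) (reorder w₁ G h q)
          where
          reorder : ∀ w g h q → w * g * h * q ≡ g * (w * h * q)
          reorder = solve-∀
        GZ′≡GZ : G * Z′ ≡ G * Z mod T
        GZ′≡GZ = +-cancelʳ-mod (r₀ * W) (≡-mod-trans inv′ (≡-mod-sym inv))
        Z′≡Z : Z′ ≡ Z mod M
        Z′≡Z = ≡-mod-divisor (divides w₁ (*-assoc w₁ h q))
          (*-cancelˡ-mod G (subst (λ m → G * Z′ ≡ G * Z mod m) T≡G*w₁hq GZ′≡GZ))

    a-periodic-away-from-p : a (x + T) ≈ a x
    a-periodic-away-from-p =
      let Z , ax≈aGZ , _ , inv = lift-and-divide p∤x ≡-mod-refl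
          Z′ , ax+T≈aGZ′ , Z′⊥q , inv′ = lift-and-divide p∤x+T (m∣k⇒x+k≡x ∣-refl x)
      in trans ax+T≈aGZ′ (trans (a-G*-resp-invariant Z′⊥q inv inv′) (sym ax≈aGZ))
      where
      p∤x+T : ¬ p ∣ x + T
      p∤x+T p∣x+T = p∤x (∣m+n∣n⇒∣m p∣x+T p∣T)

  f₁ : ℕ → Carrier
  f₁ zero    = 1#
  f₁ (suc v) = a (p ^ suc v)

  f₂ : ℕ → Carrier
  f₂ n with p ∣? n
  ... | yes _ = 0#
  ... | no _  = a n

  f₂-∣ : ∀ {n} → p ∣ n → f₂ n ≈ 0#
  f₂-∣ {n} p∣n with p ∣? n
  ... | yes _  = ≈-refl
  ... | no p∤n = contradiction p∣n p∤n

  f₂-∤ : ∀ {n} → ¬ p ∣ n → f₂ n ≈ a n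
  f₂-∤ {n} p∤n with p ∣? n
  ... | yes p∣n = contradiction p∣n p∤n
  ... | no _    = ≈-refl

  p^[αm+e]≡p^e*q^m : ∀ m e → p ^ (α * m + e) ≡ p ^ e * q ^ m + 0
  p^[αm+e]≡p^e*q^m m e = begin
    p ^ (α * m + e)       ≡⟨ ^-distribˡ-+-* p (α * m) e ⟩
    p ^ (α * m) * p ^ e   ≡⟨ cong (_* p ^ e) (^-*-assoc p α m) ⟨
    q ^ m * p ^ e         ≡⟨ *-comm (q ^ m) (p ^ e) ⟩
    p ^ e * q ^ m         ≡⟨ +-identityʳ _ ⟨
    p ^ e * q ^ m + 0     ∎
    where open ≡.≡-Reasoning

  a-p^-eventually-periodic : ∀ e → a (p ^ (α * N + e + α * D)) ≈ a (p ^ (α * N + e))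
  a-p^-eventually-periodic e = begin
    a (p ^ (α * N + e + α * D))     ≡⟨ cong (a ∘ (p ^_)) (regroup α N e D) ⟩
    a (p ^ (α * (N + D) + e))       ≡⟨ cong a (p^[αm+e]≡p^e*q^m (N + D) e) ⟩
    a (p ^ e * q ^ (N + D) + 0)     ≈⟨ kernel-eventually-periodic R {lam = q} {a = a} automatic 0 {k = 0} (s≤s z≤n) (p ^ e) ⟨
    a (p ^ e * q ^ N + 0)           ≡⟨ cong a (p^[αm+e]≡p^e*q^m N e) ⟨
    a (p ^ (α * N + e))             ∎
    where
    open ≈-Reasoning
    regroup : ∀ α n e d → α * n + e + α * d ≡ α * (n + d) + e
    regroup = solve-∀

  f₁-eventually-periodic : EventuallyPeriodic R f₁
  f₁-eventually-periodic = suc (α * N) , α * D , *-mono-≤ α≥1 D≥1 , periodic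
    where
    periodic : ∀ k → suc (α * N) ≤ k → f₁ (k + α * D) ≈ f₁ k
    periodic (suc k) αN<1+k = subst (λ m → a (p ^ (m + α * D)) ≈ a (p ^ m))
      (m+[n∸m]≡n (<⇒≤ αN<1+k)) (a-p^-eventually-periodic (suc k ∸ α * N))

  f₂-multiplicative : Multiplicative R f₂
  f₂-multiplicative m n m≥1 n≥1 m⊥n = by-cases (p ∣? m * n)
    where
    product≈0 : p ∣ m ⊎ p ∣ n → f₂ m · f₂ n ≈ 0#
    product≈0 (inj₁ p∣m) = trans (*-cong (f₂-∣ p∣m) ≈-refl) (zeroˡ (f₂ n))
    product≈0 (inj₂ p∣n) = trans (*-cong ≈-refl (f₂-∣ p∣n)) (zeroʳ (f₂ m))
    by-cases : Dec (p ∣ m * n) → f₂ (m * n) ≈ f₂ m · f₂ n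
    by-cases (yes p∣mn) = trans (f₂-∣ p∣mn) (sym (product≈0 (euclidsLemma m n p-prime p∣mn)))
    by-cases (no p∤mn) = begin
      f₂ (m * n)    ≈⟨ f₂-∤ p∤mn ⟩
      a (m * n)     ≈⟨ multiplicative m n m≥1 n≥1 m⊥n ⟩
      a m · a n     ≈⟨ *-cong (f₂-∤ (p∤mn ∘ ∣m⇒∣m*n n)) (f₂-∤ (p∤mn ∘ ∣n⇒∣m*n m)) ⟨
      f₂ m · f₂ n   ∎
      where open ≈-Reasoning

  f₂-periodic : Periodic R f₂
  f₂-periodic = T , T≥1 , λ n _ → by-cases n (p ∣? n)
    where
    by-cases : ∀ n → Dec (p ∣ n) → f₂ (n + T) ≈ f₂ n
    by-cases n (yes p∣n) = trans (f₂-∣ (∣m∣n⇒∣m+n p∣n p∣T)) (sym (f₂-∣ p∣n))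
    by-cases n (no p∤n) = begin
      f₂ (n + T)    ≈⟨ f₂-∤ (λ p∣n+T → p∤n (∣m+n∣n⇒∣m p∣n+T p∣T)) ⟩
      a (n + T)     ≈⟨ a-periodic-away-from-p p∤n ⟩
      a n           ≈⟨ f₂-∤ p∤n ⟨
      f₂ n          ∎
      where open ≈-Reasoning

  a[p^v*m]≈f₁[v]·f₂[m] : ∀ v m → ¬ p ∣ m → a (p ^ v * m) ≈ f₁ v · f₂ m
  a[p^v*m]≈f₁[v]·f₂[m] zero m p∤m = begin
    a (1 * m)     ≡⟨ cong a (*-identityˡ m) ⟩
    a m           ≈⟨ f₂-∤ p∤m ⟨
    f₂ m          ≈⟨ ·-identityˡ (f₂ m) ⟨
    1# · f₂ m     ∎
    where open ≈-Reasoning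
  a[p^v*m]≈f₁[v]·f₂[m] (suc v) m p∤m = begin
    a (p ^ suc v * m)       ≈⟨ multiplicative (p ^ suc v) m (m^n>0 p (suc v)) m≥1 p^v⊥m ⟩
    a (p ^ suc v) · a m     ≈⟨ *-cong ≈-refl (f₂-∤ p∤m) ⟨
    f₁ (suc v) · f₂ m       ∎
    where
    open ≈-Reasoning
    m≥1 : 1 ≤ m
    m≥1 = coprime⇒≥1 q>1 (p∤⇒⊥q p∤m)
    p^v⊥m : Coprime (p ^ suc v) m
    p^v⊥m = Coprimality.sym (coprime-^ʳ (∤⇒coprime p-prime p∤m) (suc v))

  a≈f₁[ν]·f₂[pFree] : ∀ n → 1 ≤ n → a n ≈ f₁ (ν p n) · f₂ (pFree p n)
  a≈f₁[ν]·f₂[pFree] n n≥1 with valuation-factorisation p p>1 n n≥1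
  ... | n≡p^ν*pFree , p∤pFree = trans (reflexive (cong a n≡p^ν*pFree)) (a[p^v*m]≈f₁[v]·f₂[m] (ν p n) (pFree p n) p∤pFree)

open CommutativeRing using (Carrier; _≈_; 1#) renaming (_*_ to _·_)

proposition5p4 : {c ℓ : Level} (R : CommutativeRing c ℓ) →
    (a : ℕ → Carrier R) (h p α : ℕ) (χ : ℤ → Carrier R) →
    .{{_ : NonZero p}} →
    Multiplicative R a →
    1 ≤ h → 1 ≤ p ^ α → Coprime h (p ^ α) →
    Automatic R (p ^ α) a →
    DirichletCharacter R (h * p ^ α) χ →
    (∀ n → 1 ≤ n → Coprime n (h * p ^ α) → _≈_ R (a n) (χ (+ n))) →
    Prime p → 1 ≤ α →
    Σ (ℕ → Carrier R) λ f₁ → Σ (ℕ → Carrier R) λ f₂ →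
      EventuallyPeriodic R f₁ × _≈_ R (f₁ 0) (1# R) ×
      Multiplicative R f₂ × Periodic R f₂ ×
      (∀ n → 1 ≤ n → _≈_ R (a n) (_·_ R (f₁ (ν p n)) (f₂ (pFree p n))))
-- The hypothesis 1 ≤ p ^ α already follows from NonZero p.
proposition5p4 R a h p α χ multiplicative h≥1 _ h⊥q automatic χ-character a≈χ p-prime α≥1 =
  f₁ , f₂ , f₁-eventually-periodic , CommutativeRing.refl R , f₂-multiplicative , f₂-periodic , a≈f₁[ν]·f₂[pFree]
  where open Proposition5p4 R a h p α χ multiplicative h≥1 h⊥q automatic χ-character a≈χ p-prime α≥1
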